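{- Assume $\Gamma$ has no slices. Let $K,L,M$ be mincuts with $[K]$ crossing $[L]$ and $[L]$ crossing $[M]$, and let $\Gamma-K=C_1\sqcup C_2$, $\Gamma-L=D_1\sqcup D_2$, $\Gamma-M=E_1\sqcup E_2$ be their components. Then it is not possible that each of $C_1\cap D_1\cap E_1$, $C_2\cap D_1\cap E_2$, $C_2\cap D_2\cap E_1$, $C_1\cap D_2\cap E_2$ contains an end, nor any arrangement obtained from this by relabelling the components.
   Context: $\Gamma=(V,E)$ is a connected graph. For $K\subseteq V$, $\Gamma-K$ is $\Gamma$ with $K$ and incident edges deleted. A vertex cut is a finite $K\subseteq V$ with $\Gamma-K$ disconnected. A ray is an infinite sequence of distinct vertices with consecutive ones adjacent; rays $r_1,r_2$ are equivalent if for every vertex cut $K$ all but finitely many vertices of $r_1\cup r_2$ lie in one component of $\Gamma-K$; ends are the equivalence classes; a vertex set contains an end if it contains a ray of it. An end cut is a vertex cut $K$ such that at least two components of $\Gamma-K$ contain rays; it is assumed end cuts exist, and a mincut is an end cut of minimal cardinality. $\Gamma$ has no slices means: for every mincut $K$, every component of $\Gamma-K$ contains a ray. A mincut $K$ induces a partition $K^{(1)}\sqcup\dots\sqcup K^{(r)}$ of the set of ends according to the component of $\Gamma-K$ containing them; mincuts are equivalent if they induce the same partition, $[K]$ denoting the class; $[K],[L]$ cross if, after relabelling, $K^{(i)}\cap L^{(j)}\neq\emptyset$ for all $i,j\in\{1,2\}$. (Crossing mincuts each have exactly two complementary components in a graph with no slices.) -}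

module Defs where

open import Data.Nat using (ℕ; suc; _≤_)
open import Data.Product using (Σ; ∃; _×_; _,_)
open import Data.Sum using (_⊎_)
open import Data.List using (List; length)
open import Data.List.Membership.Propositional using (_∈_; _∉_)
open import Data.List.Relation.Unary.Unique.Propositional using (Unique)
open import Relation.Nullary using (¬_)
open import Relation.Binary.PropositionalEquality using (_≡_)
open import Function.Definitions using (Injective)

record Graph : Set₁ where
  field
    V     : Set
    _~_   : V → V → Set
    ~-sym : ∀ {u v} → u ~ v → v ~ u

module _ (Γ : Graph) where
  open Graph Γ

  -- Vertex subsets are predicates; finite vertex sets are lists.
  Region : Set₁
  Region = V → Set

  data Reach (K : List V) (u : V) : V → Set where
    here : u ∉ K → Reach K u u
    step : ∀ {w v} → Reach K u w → w ~ v → v ∉ K → Reach K u v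

  Connected : Set
  Connected = ∀ u v → Reach [] u v
    where open import Data.List using ([])

  record Ray : Set where
    field
      vx  : ℕ → V
      inj : Injective _≡_ _≡_ vx
      adj : ∀ n → vx n ~ vx (suc n)
  open Ray public

  VertexCut : List V → Set
  VertexCut K = Σ V λ u → Σ V λ v → u ∉ K × v ∉ K × ¬ Reach K u v

  InTails : Ray → Ray → ℕ → V → Set
  InTails r₁ r₂ N v = ∃ λ m → N ≤ m × (v ≡ vx r₁ m ⊎ v ≡ vx r₂ m)

  _≈ʳ_ : Ray → Ray → Set
  r₁ ≈ʳ r₂ = (K : List V) → VertexCut K →
             ∃ λ N → ∀ u v → InTails r₁ r₂ N u → InTails r₁ r₂ N v → Reach K u v

  RayIn : Region → Ray → Set
  RayIn X r = ∀ n → X (vx r n)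

  ContainsEnd : Region → Set
  ContainsEnd X = Σ Ray λ r → RayIn X r

  -- some end is contained both in X and in Y (each contains a ray of that end)
  CommonEnd : Region → Region → Set
  CommonEnd X Y = Σ Ray λ r → Σ Ray λ s → r ≈ʳ s × RayIn X r × RayIn Y s

  Comp : List V → V → Region
  Comp K c v = Reach K c v

  EndCut : List V → Set
  EndCut K = VertexCut K ×
    (Σ Ray λ r → Σ Ray λ s → Σ V λ a → Σ V λ b →
       ¬ Reach K a b × RayIn (Comp K a) r × RayIn (Comp K b) s)

  -- mincut: end cut (as a set, given by a duplicate-free list) of minimal cardinality
  Mincut : List V → Set
  Mincut K = Unique K × EndCut K ×
    (∀ L → Unique L → EndCut L → length K ≤ length L)

  NoSlices : Set
  NoSlices = ∀ K → Mincut K → ∀ v → v ∉ K → ContainsEnd (Comp K v)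

  -- c₁, c₂ represent exactly the two components of Γ - K: Γ - K = C₁ ⊔ C₂
  TwoComponents : List V → V → V → Set
  TwoComponents K c₁ c₂ = c₁ ∉ K × c₂ ∉ K × ¬ Reach K c₁ c₂ ×
    (∀ v → v ∉ K → Reach K c₁ v ⊎ Reach K c₂ v)

  -- crossing of [K] and [L] whose complements are C₁ ⊔ C₂ and D₁ ⊔ D₂:
  -- K^(i) ∩ L^(j) ≠ ∅ for all i, j ∈ {1,2}
  Cross : Region → Region → Region → Region → Set
  Cross C₁ C₂ D₁ D₂ =
    CommonEnd C₁ D₁ × CommonEnd C₁ D₂ × CommonEnd C₂ D₁ × CommonEnd C₂ D₂

  _∩_ : Region → Region → Region
  (X ∩ Y) v = X v × Y v

-- Record for every vertex its position (on the cut, or in which component) with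
-- respect to K, L and M; the four cells of the statement are the positions
-- (a, b, a xor b) with a, b ∈ {1, 2}. The boundary of a cell, i.e. the vertices of
-- K ∪ L ∪ M each of whose positions is the cut or the cell's side, separates the
-- ray of that cell from the ray of another one, so it is an end cut and has at
-- least |K| vertices. Any two positions of a cell determine the third, so a vertex
-- lying on exactly j of the cuts is in j + [j = 3] boundaries, and summing over the
-- four cells gives 4|K| ≤ |K| + |L| + |M| + |K ∩ L ∩ M| ≤ 3|K| + |K ∩ L ∩ M|.
-- Hence K ⊆ L, and the rays of C₁D₁E₁ and C₂D₁E₂, joined in Γ - L, are joined in
-- Γ - K, which is impossible. Positions are only decidable up to double negation,
-- which suffices since the goal is ⊥.

module Submission where

open import Defs
open import Algebra.Properties.CommutativeSemigroup using (interchange)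
open import Data.Bool using (Bool; true; false; not; _∧_; _∨_; _xor_; T; if_then_else_)
open import Data.Bool.Properties using (T?; T-∧; T-∨)
open import Data.Empty using (⊥-elim)
open import Data.List using (List; []; _∷_; _++_; length; map; filter; filterᵇ)
open import Data.List.Fresh using (List#; fromList)
import Data.List.Fresh as Fresh
import Data.List.Fresh.Relation.Unary.Any as Any#
open import Data.List.Fresh.Membership.Setoid.Properties using (injection)
open import Data.List.Membership.Propositional using (_∈_; _∉_)
open import Data.List.Membership.Propositional.Properties
  using (∈-map⁺; ∈-map⁻; ∈-++⁺ˡ; ∈-++⁺ʳ; ∈-++⁻; ∈-filter⁺; ∈-filter⁻; ∈-map∘filter⁻)
open import Data.List.Properties
  using (length-map; length-++; length-filter; filter-++; filter-none; filter-complete)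
open import Data.List.Relation.Binary.Subset.Propositional using (_⊆_)
open import Data.List.Relation.Unary.All as All using (All; []; _∷_)
open import Data.List.Relation.Unary.All.Properties using (all-filter)
open import Data.List.Relation.Unary.AllPairs using (AllPairs; []; _∷_)
import Data.List.Relation.Unary.AllPairs.Properties as AllPairs
open import Data.List.Relation.Unary.Any using (here; there)
open import Data.List.Relation.Unary.Unique.Propositional using (Unique)
open import Data.Nat using (ℕ; suc; _+_; _≤_; _≤ᵇ_; z≤n)
open import Data.Nat.ListAction using (sum)
open import Data.Nat.Properties
  using ( ≤ᵇ⇒≤; +-mono-≤; ≤-refl; ≤-trans; ≤-antisym; +-cancelˡ-≤; +-identityʳ
        ; +-commutativeSemigroup)
open import Data.Product using (Σ; ∃; _×_; _,_; proj₁; proj₂)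
open import Data.Sum as Sum using (_⊎_; inj₁; inj₂; [_,_])
open import Data.Unit using (tt)
open import Effect.Monad using (RawMonad)
open import Function using (_∘_; _on_; id)
open import Function.Bundles using (Equivalence)
open import Level using (0ℓ)
open import Relation.Binary.PropositionalEquality
  using (_≡_; _≢_; refl; sym; trans; cong; cong₂; subst; subst₂; setoid; module ≡-Reasoning)
open import Relation.Nullary using (¬_; Dec; yes; no)
open import Relation.Nullary.Decidable using (¬?; _×-dec_; ¬¬-excluded-middle)
open import Relation.Nullary.Negation using (DoubleNegation; ¬¬-Monad)
open import Relation.Unary using (Decidable)

open RawMonad (¬¬-Monad {0ℓ})

count : {A : Set} → (A → Bool) → List A → ℕ
count p xs = length (filterᵇ p xs)

count-∷ : ∀ {A : Set} (p : A → Bool) x xs → count p (x ∷ xs) ≡ (if p x then 1 else 0) + count p xs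
count-∷ p x xs with p x
... | true = refl
... | false = refl

hits : {B : Set} → List (B → Bool) → B → ℕ
hits ps y = count (λ p → p y) ps

module _ {A B : Set} where

  total : List (B → Bool) → (A → B) → List A → ℕ
  total ps f xs = sum (map (λ p → count (p ∘ f) xs) ps)

  total-[] : ∀ ps (f : A → B) → total ps f [] ≡ 0
  total-[] [] f = refl
  total-[] (p ∷ ps) f = total-[] ps f

  total-∷ : ∀ ps (f : A → B) x xs → total ps f (x ∷ xs) ≡ hits ps (f x) + total ps f xs
  total-∷ [] f x xs = refl
  total-∷ (p ∷ ps) f x xs
    rewrite count-∷ (p ∘ f) x xs | total-∷ ps f x xs | count-∷ (λ q → q (f x)) p ps =
    interchange +-commutativeSemigroup (if p (f x) then 1 else 0) (count (p ∘ f) xs)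
                (hits ps (f x)) (total ps f xs)

  total-mono : ∀ ps qs (f : A → B) {xs} → All (λ x → hits ps (f x) ≤ hits qs (f x)) xs →
               total ps f xs ≤ total qs f xs
  total-mono ps qs f {[]} [] rewrite total-[] ps f = z≤n
  total-mono ps qs f {x ∷ xs} (h ∷ hs) rewrite total-∷ ps f x xs | total-∷ qs f x xs =
    +-mono-≤ h (total-mono ps qs f hs)

module _ {A : Set} where

  private
    toFresh : ∀ {xs : List A} → Unique xs → List# A _≢_
    toFresh = fromList

    ∈-toFresh⁺ : ∀ {x xs} (u : Unique xs) → x ∈ xs → Any#.Any (x ≡_) (toFresh u)
    ∈-toFresh⁺ (_ ∷ _) (here x≡y) = Any#.here x≡y
    ∈-toFresh⁺ (_ ∷ u) (there x∈xs) = Any#.there (∈-toFresh⁺ u x∈xs)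

    ∈-toFresh⁻ : ∀ {x xs} (u : Unique xs) → Any#.Any (x ≡_) (toFresh u) → x ∈ xs
    ∈-toFresh⁻ (_ ∷ _) (Any#.here x≡y) = here x≡y
    ∈-toFresh⁻ (_ ∷ u) (Any#.there x∈xs) = there (∈-toFresh⁻ u x∈xs)

    length-toFresh : ∀ {xs} (u : Unique xs) → Fresh.length (toFresh u) ≡ length xs
    length-toFresh [] = refl
    length-toFresh (_ ∷ u) = cong suc (length-toFresh u)

  unique-⊆⇒length≤ : ∀ {xs ys : List A} → Unique xs → Unique ys → xs ⊆ ys → length xs ≤ length ys
  unique-⊆⇒length≤ u v xs⊆ys =
    subst₂ _≤_ (length-toFresh u) (length-toFresh v)
      (injection (setoid A) id (∈-toFresh⁺ v ∘ xs⊆ys ∘ ∈-toFresh⁻ u))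

4k≤a+b+c+d⇒k≤d : ∀ {k a b c d} → k + (k + (k + (k + 0))) ≤ a + (b + (c + (d + 0))) →
                 a ≤ k → b ≤ k → c ≤ k → k ≤ d
4k≤a+b+c+d⇒k≤d {k} {d = d} h a≤k b≤k c≤k =
  subst₂ _≤_ (+-identityʳ k) (+-identityʳ d)
    (+-cancelˡ-≤ k _ _ (+-cancelˡ-≤ k _ _ (+-cancelˡ-≤ k _ _
      (≤-trans h (+-mono-≤ a≤k (+-mono-≤ b≤k (+-mono-≤ c≤k ≤-refl)))))))

module _ {Γ : Graph} where
  open Graph Γ

  Reach-target∉ : ∀ {X u v} → Reach Γ X u v → v ∉ X
  Reach-target∉ (here u∉X) = u∉X
  Reach-target∉ (step _ _ v∉X) = v∉X

  Reach-trans : ∀ {X u v w} → Reach Γ X u v → Reach Γ X v w → Reach Γ X u w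
  Reach-trans r (here _) = r
  Reach-trans r (step r′ v~w w∉X) = step (Reach-trans r r′) v~w w∉X

  Reach-sym : ∀ {X u v} → Reach Γ X u v → Reach Γ X v u
  Reach-sym (here u∉X) = here u∉X
  Reach-sym (step r w~v v∉X) =
    Reach-trans (step (here v∉X) (~-sym w~v) (Reach-target∉ r)) (Reach-sym r)

  Reach-antimono : ∀ {X Y u v} → X ⊆ Y → Reach Γ Y u v → Reach Γ X u v
  Reach-antimono X⊆Y (here u∉Y) = here (u∉Y ∘ X⊆Y)
  Reach-antimono X⊆Y (step r w~v v∉Y) = step (Reach-antimono X⊆Y r) w~v (v∉Y ∘ X⊆Y)

  ray-in-component : ∀ {X} (r : Ray Γ) → (∀ n → vx r n ∉ X) → RayIn Γ (Comp Γ X (vx r 0)) r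
  ray-in-component r avoid 0 = here (avoid 0)
  ray-in-component r avoid (suc n) = step (ray-in-component r avoid n) (adj r n) (avoid (suc n))

  separated-rays⇒EndCut : ∀ {X} (r s : Ray Γ) → (∀ n → vx r n ∉ X) → (∀ n → vx s n ∉ X) →
                          ¬ Reach Γ X (vx r 0) (vx s 0) → EndCut Γ X
  separated-rays⇒EndCut r s r∉ s∉ unreachable =
    (vx r 0 , vx s 0 , r∉ 0 , s∉ 0 , unreachable) ,
    r , s , vx r 0 , vx s 0 , unreachable , ray-in-component r r∉ , ray-in-component s s∉

data Loc : Set where
  cut  : Loc
  side : Bool → Loc

isCut : Loc → Bool
isCut cut = true
isCut (side _) = false

near : Loc → Bool → Bool
near cut _ = true
near (side false) s = not s
near (side true) s = s

near-refl : ∀ s → T (near (side s) s)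
near-refl false = tt
near-refl true = tt

every : (Loc → Bool) → Bool
every f = f cut ∧ f (side false) ∧ f (side true)

every-sound : ∀ f → T (every f) → ∀ l → T (f l)
every-sound f h cut = proj₁ (Equivalence.to (T-∧ {f cut}) h)
every-sound f h (side s) = lookup s (proj₂ (Equivalence.to (T-∧ {f cut}) h))
  where
  lookup : ∀ s → T (f (side false) ∧ f (side true)) → T (f (side s))
  lookup false = proj₁ ∘ Equivalence.to (T-∧ {f (side false)})
  lookup true = proj₂ ∘ Equivalence.to (T-∧ {f (side false)})

every³-sound : ∀ (f : Loc × Loc × Loc → Bool) →
               T (every λ k → every λ l → every λ m → f (k , l , m)) → ∀ x → T (f x)
every³-sound f h (k , l , m) =
  every-sound (λ m → f (k , l , m))
    (every-sound (λ l → every λ m → f (k , l , m))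
      (every-sound (λ k → every λ l → every λ m → f (k , l , m)) h k) l) m

T-not-∨⇒ : ∀ x {y} → T (not x ∨ y) → T x → T y
T-not-∨⇒ true y _ = y

module TwoComponentCut {Γ : Graph} {X : List (Graph.V Γ)} {c₁ c₂ : Graph.V Γ}
                       (two : TwoComponents Γ X c₁ c₂) where
  open Graph Γ

  centre : Bool → V
  centre false = c₁
  centre true = c₂

  Component : Bool → Region Γ
  Component s = Comp Γ X (centre s)

  centres-apart : ¬ Reach Γ X c₁ c₂
  centres-apart = proj₁ (proj₂ (proj₂ two))

  components-cover : ∀ v → v ∉ X → Reach Γ X c₁ v ⊎ Reach Γ X c₂ v
  components-cover = proj₂ (proj₂ (proj₂ two))

  Position : Loc → V → Set
  Position cut v = v ∈ X
  Position (side s) v = Component s v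

  sides-disjoint : ∀ s {v} → Position (side s) v → ¬ Position (side (not s)) v
  sides-disjoint false r r′ = centres-apart (Reach-trans r (Reach-sym r′))
  sides-disjoint true r r′ = centres-apart (Reach-trans r′ (Reach-sym r))

  position-unique : ∀ {l l′ v} → Position l v → Position l′ v → l ≡ l′
  position-unique {cut} {cut} _ _ = refl
  position-unique {cut} {side _} v∈X r = ⊥-elim (Reach-target∉ r v∈X)
  position-unique {side _} {cut} r v∈X = ⊥-elim (Reach-target∉ r v∈X)
  position-unique {side false} {side false} _ _ = refl
  position-unique {side false} {side true} r r′ = ⊥-elim (sides-disjoint false r r′)
  position-unique {side true} {side false} r r′ = ⊥-elim (sides-disjoint true r r′)
  position-unique {side true} {side true} _ _ = refl

  position : ∀ v → DoubleNegation (∃ λ l → Position l v)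
  position v = do
    v∈X? ← ¬¬-excluded-middle
    pure (classify v∈X?)
    where
    classify : Dec (v ∈ X) → ∃ λ l → Position l v
    classify (yes v∈X) = cut , v∈X
    classify (no v∉X) with components-cover v v∉X
    ... | inj₁ r = side false , r
    ... | inj₂ r = side true , r

  position-near : ∀ {s l w v} → Position (side s) w → w ~ v → Position l v → T (near l s)
  position-near {l = cut} _ _ _ = tt
  position-near {s} {side t} r w~v r′ with position-unique (step r w~v (Reach-target∉ r′)) r′
  ... | refl = near-refl s

  isCut⇒∈ : ∀ {l v} → Position l v → T (isCut l) → v ∈ X
  isCut⇒∈ {cut} v∈X _ = v∈X

  ∈⇒isCut : ∀ {l v} → Position l v → v ∈ X → T (isCut l)
  ∈⇒isCut p v∈X with position-unique p v∈X
  ... | refl = tt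

module ThreeCuts {Γ : Graph} {K L M : List (Graph.V Γ)} {c₁ c₂ d₁ d₂ e₁ e₂ : Graph.V Γ}
                 (twoK : TwoComponents Γ K c₁ c₂) (twoL : TwoComponents Γ L d₁ d₂)
                 (twoM : TwoComponents Γ M e₁ e₂) where
  open Graph Γ
  module CutK = TwoComponentCut twoK
  module CutL = TwoComponentCut twoL
  module CutM = TwoComponentCut twoM

  Address : Set
  Address = Loc × Loc × Loc

  At : Address → V → Set
  At (k , l , m) v = CutK.Position k v × CutL.Position l v × CutM.Position m v

  Located : V → Set
  Located v = Σ Address λ a → At a v

  Tagged : Set
  Tagged = Σ V Located

  vertex : Tagged → V
  vertex = proj₁

  address : Tagged → Address
  address = proj₁ ∘ proj₂

  locate : ∀ v → DoubleNegation (Located v)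
  locate v = do
    k , pk ← CutK.position v
    l , pl ← CutL.position v
    m , pm ← CutM.position v
    pure ((k , l , m) , pk , pl , pm)

  tag : ∀ xs → DoubleNegation (∃ λ (ts : List Tagged) → map vertex ts ≡ xs)
  tag [] = pure ([] , refl)
  tag (x ∷ xs) = do
    p ← locate x
    ts , ts≡ ← tag xs
    pure ((x , p) ∷ ts , cong (x ∷_) ts≡)

  address-unique : ∀ {v} (p q : Located v) → proj₁ p ≡ proj₁ q
  address-unique (_ , pk , pl , pm) (_ , qk , ql , qm) =
    cong₂ _,_ (CutK.position-unique pk qk)
              (cong₂ _,_ (CutL.position-unique pl ql) (CutM.position-unique pm qm))

  vertices-differ : ∀ (q : Address → Bool) {a b} → T (q (address a)) → ¬ T (q (address b)) →
                    vertex a ≢ vertex b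
  vertices-differ q {_ , p} {_ , p′} qa ¬qb refl = ¬qb (subst (T ∘ q) (address-unique p p′) qa)

  tagged⁺ : ∀ {ts xs x} → map vertex ts ≡ xs → x ∈ xs → Σ (Located x) λ p → (x , p) ∈ ts
  tagged⁺ {ts} refl x∈ with ∈-map⁻ vertex x∈
  ... | (_ , p) , t∈ , refl = p , t∈

  tagged⁻ : ∀ {ts xs t} → map vertex ts ≡ xs → t ∈ ts → vertex t ∈ xs
  tagged⁻ refl t∈ = ∈-map⁺ vertex t∈

  tags-distinct : ∀ {ts xs} → map vertex ts ≡ xs → Unique xs → AllPairs (_≢_ on vertex) ts
  tags-distinct refl u = AllPairs.map⁻ u

  cutK cutL cutM hasCut allCut : Address → Bool
  cutK (k , _ , _) = isCut k
  cutL (_ , l , _) = isCut l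
  cutM (_ , _ , m) = isCut m
  hasCut a = cutK a ∨ cutL a ∨ cutM a
  allCut a = cutK a ∧ cutL a ∧ cutM a

  cutK-sound : ∀ t → T (cutK (address t)) → vertex t ∈ K
  cutK-sound (_ , _ , pk , _) = CutK.isCut⇒∈ pk

  cutL-sound : ∀ t → T (cutL (address t)) → vertex t ∈ L
  cutL-sound (_ , _ , _ , pl , _) = CutL.isCut⇒∈ pl

  cutM-sound : ∀ t → T (cutM (address t)) → vertex t ∈ M
  cutM-sound (_ , _ , _ , _ , pm) = CutM.isCut⇒∈ pm

  cutK-complete : ∀ t → vertex t ∈ K → T (cutK (address t))
  cutK-complete (_ , _ , pk , _) = CutK.∈⇒isCut pk

  cutL-complete : ∀ t → vertex t ∈ L → T (cutL (address t))
  cutL-complete (_ , _ , _ , pl , _) = CutL.∈⇒isCut pl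

  cutM-complete : ∀ t → vertex t ∈ M → T (cutM (address t))
  cutM-complete (_ , _ , _ , _ , pm) = CutM.∈⇒isCut pm

  hasCut-complete : ∀ t → vertex t ∈ K ++ L ++ M → T (hasCut (address t))
  hasCut-complete t =
    Equivalence.from (T-∨ {cutK a}) ∘
    Sum.map (cutK-complete t)
            (Equivalence.from (T-∨ {cutL a}) ∘
             Sum.map (cutL-complete t) (cutM-complete t) ∘ ∈-++⁻ L) ∘
    ∈-++⁻ K
    where a = address t

  allCut⇒cutK : ∀ x → T (allCut x) → T (cutK x)
  allCut⇒cutK x = proj₁ ∘ Equivalence.to (T-∧ {cutK x})

  allCut⇒cutL : ∀ x → T (allCut x) → T (cutL x)
  allCut⇒cutL x = proj₁ ∘ Equivalence.to (T-∧ {cutL x}) ∘ proj₂ ∘ Equivalence.to (T-∧ {cutK x})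

  Cell : Set
  Cell = Bool × Bool

  cells : List Cell
  cells = (false , false) ∷ (true , false) ∷ (true , true) ∷ (false , true) ∷ []

  -- The cell (a , b) is C ∩ D ∩ E with sides a, b and a xor b (false standing for index 1);
  -- cells lists C₁D₁E₁, C₂D₁E₂, C₂D₂E₁, C₁D₂E₂.
  InCell : Cell → Region Γ
  InCell (a , b) = _∩_ Γ (_∩_ Γ (CutK.Component a) (CutL.Component b)) (CutM.Component (a xor b))

  InCell∉ : ∀ e {v} → InCell e v → v ∉ K ++ L ++ M
  InCell∉ _ ((vK , vL) , vM) =
    [ Reach-target∉ vK , [ Reach-target∉ vL , Reach-target∉ vM ] ∘ ∈-++⁻ L ] ∘ ∈-++⁻ K

  flip : Cell → Cell
  flip (a , b) = not a , b

  cells-disjoint : ∀ e {v} → InCell e v → ¬ InCell (flip e) v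
  cells-disjoint (a , _) ((vK , _) , _) ((vK′ , _) , _) = CutK.sides-disjoint a vK vK′

  closure : Cell → Address → Bool
  closure (a , b) (k , l , m) = near k a ∧ near l b ∧ near m (a xor b)

  cutCounts : List (Address → Bool)
  cutCounts = cutK ∷ cutL ∷ cutM ∷ allCut ∷ []

  -- An address on exactly j of the cuts lies in the closure of j + [j = 3] cells;
  -- checked by evaluation on all 27 addresses.
  closure-hits : ∀ x → T (hasCut x) → hits (map closure cells) x ≤ hits cutCounts x
  closure-hits x = ≤ᵇ⇒≤ _ _ ∘ T-not-∨⇒ (hasCut x) (every³-sound check tt x)
    where
    check : Address → Bool
    check x = not (hasCut x) ∨ (hits (map closure cells) x ≤ᵇ hits cutCounts x)

  module Tagging {K̂ L̂ M̂ : List Tagged}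
                 (K̂≡ : map vertex K̂ ≡ K) (L̂≡ : map vertex L̂ ≡ L) (M̂≡ : map vertex M̂ ≡ M)
                 (uK : Unique K) (uL : Unique L) (uM : Unique M) where

    Off : (Address → Bool) → Tagged → Set
    Off q t = ¬ T (q (address t))

    off? : ∀ q → Decidable (Off q)
    off? q t = ¬? (T? (q (address t)))

    L̂∖K : List Tagged
    L̂∖K = filter (off? cutK) L̂

    offKL? : Decidable (λ t → Off cutK t × Off cutL t)
    offKL? t = off? cutK t ×-dec off? cutL t

    M̂∖KL : List Tagged
    M̂∖KL = filter offKL? M̂

    union : List Tagged
    union = K̂ ++ L̂∖K ++ M̂∖KL

    outside-K : ∀ {t} → t ∈ L̂∖K ++ M̂∖KL → Off cutK t
    outside-K t∈ with ∈-++⁻ L̂∖K t∈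
    ... | inj₁ t∈L̂∖K = proj₂ (∈-filter⁻ (off? cutK) {xs = L̂} t∈L̂∖K)
    ... | inj₂ t∈M̂∖KL = proj₁ (proj₂ (∈-filter⁻ offKL? {xs = M̂} t∈M̂∖KL))

    union-sound : ∀ {t} → t ∈ union → vertex t ∈ K ++ L ++ M
    union-sound t∈ with ∈-++⁻ K̂ t∈
    ... | inj₁ t∈K̂ = ∈-++⁺ˡ (tagged⁻ K̂≡ t∈K̂)
    ... | inj₂ t∈rest with ∈-++⁻ L̂∖K t∈rest
    ...   | inj₁ t∈L̂∖K = ∈-++⁺ʳ K (∈-++⁺ˡ (tagged⁻ L̂≡ (proj₁ (∈-filter⁻ (off? cutK) t∈L̂∖K))))
    ...   | inj₂ t∈M̂∖KL = ∈-++⁺ʳ K (∈-++⁺ʳ L (tagged⁻ M̂≡ (proj₁ (∈-filter⁻ offKL? t∈M̂∖KL))))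

    from-K : ∀ {x} → x ∈ K → Σ (Located x) λ p → (x , p) ∈ union
    from-K x∈K with tagged⁺ K̂≡ x∈K
    ... | p , t∈ = p , ∈-++⁺ˡ t∈

    from-L : ∀ {x} → x ∈ L → Σ (Located x) λ p → (x , p) ∈ union
    from-L x∈L with tagged⁺ L̂≡ x∈L
    ... | p , t∈ with T? (cutK (proj₁ p))
    ...   | yes inK = from-K (cutK-sound (_ , p) inK)
    ...   | no offK = p , ∈-++⁺ʳ K̂ (∈-++⁺ˡ (∈-filter⁺ (off? cutK) t∈ offK))

    from-M : ∀ {x} → x ∈ M → Σ (Located x) λ p → (x , p) ∈ union
    from-M x∈M with tagged⁺ M̂≡ x∈M
    ... | p , t∈ with T? (cutK (proj₁ p)) | T? (cutL (proj₁ p))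
    ...   | yes inK | _ = from-K (cutK-sound (_ , p) inK)
    ...   | no _ | yes inL = from-L (cutL-sound (_ , p) inL)
    ...   | no offK | no offL = p , ∈-++⁺ʳ K̂ (∈-++⁺ʳ L̂∖K (∈-filter⁺ offKL? t∈ (offK , offL)))

    union-complete : ∀ {x} → x ∈ K ++ L ++ M → Σ (Located x) λ p → (x , p) ∈ union
    union-complete x∈ with ∈-++⁻ K x∈
    ... | inj₁ x∈K = from-K x∈K
    ... | inj₂ x∈LM with ∈-++⁻ L x∈LM
    ...   | inj₁ x∈L = from-L x∈L
    ...   | inj₂ x∈M = from-M x∈M

    union-distinct : AllPairs (_≢_ on vertex) union
    union-distinct =
      AllPairs.++⁺ (tags-distinct K̂≡ uK)
        (AllPairs.++⁺ (AllPairs.filter⁺ (off? cutK) (tags-distinct L̂≡ uL))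
                      (AllPairs.filter⁺ offKL? (tags-distinct M̂≡ uM)) distinct-L̂-M̂)
        distinct-K̂-rest
      where
      distinct-K̂-rest : All (λ s → All (λ t → vertex s ≢ vertex t) (L̂∖K ++ M̂∖KL)) K̂
      distinct-K̂-rest = All.tabulate λ {s} s∈ → All.tabulate λ {t} t∈ →
        vertices-differ cutK {s} {t} (cutK-complete s (tagged⁻ K̂≡ s∈)) (outside-K t∈)
      distinct-L̂-M̂ : All (λ s → All (λ t → vertex s ≢ vertex t) M̂∖KL) L̂∖K
      distinct-L̂-M̂ = All.tabulate λ {s} s∈ → All.tabulate λ {t} t∈ →
        vertices-differ cutL {s} {t}
          (cutL-complete s (tagged⁻ L̂≡ (proj₁ (∈-filter⁻ (off? cutK) {xs = L̂} s∈))))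
          (proj₂ (proj₂ (∈-filter⁻ offKL? {xs = M̂} t∈)))

    vertices : (Address → Bool) → List V
    vertices q = map vertex (filterᵇ (q ∘ address) union)

    vertices-unique : ∀ q → Unique (vertices q)
    vertices-unique q = AllPairs.map⁺ (AllPairs.filter⁺ (T? ∘ q ∘ address) union-distinct)

    length-vertices : ∀ q → length (vertices q) ≡ count (q ∘ address) union
    length-vertices q = length-map vertex (filterᵇ (q ∘ address) union)

    count≤length : ∀ q {Y} → Unique Y → (∀ t → T (q (address t)) → vertex t ∈ Y) →
                   count (q ∘ address) union ≤ length Y
    count≤length q {Y} uY sound =
      subst (_≤ length Y) (length-vertices q)
        (unique-⊆⇒length≤ (vertices-unique q) uY (in-Y ∘ ∈-map∘filter⁻ vertex (T? ∘ q ∘ address)))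
      where
      in-Y : ∀ {x} → ∃ (λ t → t ∈ union × x ≡ vertex t × T (q (address t))) → x ∈ Y
      in-Y (t , _ , refl , qt) = sound t qt

    count-allCut : count (allCut ∘ address) union ≡ count (allCut ∘ address) K̂
    count-allCut = begin
      length (filter P? (K̂ ++ rest))                 ≡⟨ cong length (filter-++ P? K̂ rest) ⟩
      length (filter P? K̂ ++ filter P? rest)         ≡⟨ length-++ (filter P? K̂) ⟩
      length (filter P? K̂) + length (filter P? rest) ≡⟨ cong (λ zs → length (filter P? K̂) + length zs)
                                                             (filter-none P? (All.tabulate none)) ⟩
      length (filter P? K̂) + 0                       ≡⟨ +-identityʳ _ ⟩
      length (filter P? K̂)                           ∎
      where
      open ≡-Reasoning
      rest = L̂∖K ++ M̂∖KL
      P? = T? ∘ allCut ∘ address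
      none : ∀ {t} → t ∈ rest → ¬ T (allCut (address t))
      none {t} t∈ = outside-K t∈ ∘ allCut⇒cutK (address t)

    boundary : Cell → List V
    boundary e = vertices (closure e)

    boundary⊆ : ∀ e → boundary e ⊆ K ++ L ++ M
    boundary⊆ e x∈ with ∈-map∘filter⁻ vertex (T? ∘ closure e ∘ address) x∈
    ... | _ , t∈ , refl , _ = union-sound t∈

    boundary-complete : ∀ e {t} → t ∈ union → T (closure e (address t)) → vertex t ∈ boundary e
    boundary-complete e t∈ c = ∈-map⁺ vertex (∈-filter⁺ (T? ∘ closure e ∘ address) t∈ c)

    cell-step : ∀ e {w v} → InCell e w → w ~ v → v ∉ boundary e → InCell e v
    cell-step e@(a , b) {v = v} ((wK , wL) , wM) w~v v∉∂ =
      (step wK w~v (v∉ ∘ ∈-++⁺ˡ) , step wL w~v (v∉ ∘ ∈-++⁺ʳ K ∘ ∈-++⁺ˡ)) ,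
      step wM w~v (v∉ ∘ ∈-++⁺ʳ K ∘ ∈-++⁺ʳ L)
      where
      v∉ : v ∉ K ++ L ++ M
      v∉ v∈ with union-complete v∈
      ... | ((k , l , m) , pk , pl , pm) , t∈ = v∉∂ (boundary-complete e t∈ closed)
        where
        closed : T (closure e (k , l , m))
        closed = Equivalence.from (T-∧ {near k a})
          (CutK.position-near wK w~v pk , Equivalence.from (T-∧ {near l b})
            (CutL.position-near wL w~v pl , CutM.position-near wM w~v pm))

    cell-reach : ∀ e {u v} → InCell e u → Reach Γ (boundary e) u v → InCell e v
    cell-reach e u∈ (here _) = u∈
    cell-reach e u∈ (step r w~v v∉) = cell-step e (cell-reach e u∈ r) w~v v∉

    boundary-endCut : (∀ e → ContainsEnd Γ (InCell e)) → ∀ e → EndCut Γ (boundary e)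
    boundary-endCut ends e with ends e | ends (flip e)
    ... | r , r∈ | s , s∈ =
      separated-rays⇒EndCut r s (λ n → avoids e (r∈ n)) (λ n → avoids (flip e) (s∈ n))
        λ path → cells-disjoint e (cell-reach e (r∈ 0) path) (s∈ 0)
      where
      avoids : ∀ e′ {v} → InCell e′ v → v ∉ boundary e
      avoids e′ v∈ = InCell∉ e′ v∈ ∘ boundary⊆ e

    4|K|≤Σ|boundary| : (∀ e → length K ≤ length (boundary e)) →
                       let k = length K in
                       k + (k + (k + (k + 0))) ≤ total (map closure cells) address union
    4|K|≤Σ|boundary| big =
      +-mono-≤ (bound (false , false)) (+-mono-≤ (bound (true , false))
        (+-mono-≤ (bound (true , true)) (+-mono-≤ (bound (false , true)) z≤n)))
      where
      bound : ∀ e → length K ≤ count (closure e ∘ address) union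
      bound e = subst (length K ≤_) (length-vertices (closure e)) (big e)

    |K|≤count-allCut : (∀ e → length K ≤ length (boundary e)) →
                       length L ≤ length K → length M ≤ length K →
                       length K ≤ count (allCut ∘ address) K̂
    |K|≤count-allCut big L≤K M≤K =
      subst (length K ≤_) count-allCut
        (4k≤a+b+c+d⇒k≤d (≤-trans (4|K|≤Σ|boundary| big) closure-total)
          (count≤length cutK uK cutK-sound)
          (≤-trans (count≤length cutL uL cutL-sound) L≤K)
          (≤-trans (count≤length cutM uM cutM-sound) M≤K))
      where
      closure-total : total (map closure cells) address union ≤ total cutCounts address union
      closure-total = total-mono (map closure cells) cutCounts address
        (All.tabulate λ {t} t∈ → closure-hits (address t) (hasCut-complete t (union-sound t∈)))

    K⊆L : length K ≤ count (allCut ∘ address) K̂ → K ⊆ L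
    K⊆L K≤ x∈K with tagged⁺ K̂≡ x∈K
    ... | p , t∈ = cutL-sound (_ , p) (allCut⇒cutL (proj₁ p) (All.lookup allCut-K̂ t∈))
      where
      P? = T? ∘ allCut ∘ address
      length-K̂ : length K̂ ≡ length K
      length-K̂ = trans (sym (length-map vertex K̂)) (cong length K̂≡)
      all-kept : length (filter P? K̂) ≡ length K̂
      all-kept = ≤-antisym (length-filter P? K̂)
                           (subst (_≤ length (filter P? K̂)) (sym length-K̂) K≤)
      allCut-K̂ : All (T ∘ allCut ∘ address) K̂
      allCut-K̂ = subst (All _) (filter-complete P? all-kept) (all-filter P? K̂)

  cells⇒K⊆L : Mincut Γ K → Mincut Γ L → Mincut Γ M → (∀ e → ContainsEnd Γ (InCell e)) →
              DoubleNegation (K ⊆ L)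
  cells⇒K⊆L (uK , endK , minK) (uL , _ , minL) (uM , _ , minM) ends = do
    K̂ , K̂≡ ← tag K
    L̂ , L̂≡ ← tag L
    M̂ , M̂≡ ← tag M
    let open Tagging K̂≡ L̂≡ M̂≡ uK uL uM
    let boundaries-large = λ e → minK (boundary e) (vertices-unique _) (boundary-endCut ends e)
    pure λ {x} → K⊆L (|K|≤count-allCut boundaries-large (minL K uK endK) (minM K uK endK)) {x}

  no-four-cells : Mincut Γ K → Mincut Γ L → Mincut Γ M → ¬ (∀ e → ContainsEnd Γ (InCell e))
  no-four-cells mK mL mM ends = cells⇒K⊆L mK mL mM ends λ K⊆L →
    CutK.sides-disjoint false
      (Reach-trans u∈C₁ (Reach-antimono K⊆L (Reach-trans (Reach-sym u∈D₁) w∈D₁))) w∈C₂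
    where
    u∈C₁ = proj₁ (proj₁ (proj₂ (ends (false , false)) 0))
    u∈D₁ = proj₂ (proj₁ (proj₂ (ends (false , false)) 0))
    w∈C₂ = proj₁ (proj₁ (proj₂ (ends (true , false)) 0))
    w∈D₁ = proj₂ (proj₁ (proj₂ (ends (true , false)) 0))

mainTheorem13 : (Γ : Graph) → Connected Γ → NoSlices Γ →
    (K L M : List (Graph.V Γ)) → Mincut Γ K → Mincut Γ L → Mincut Γ M →
    (c₁ c₂ d₁ d₂ e₁ e₂ : Graph.V Γ) →
    TwoComponents Γ K c₁ c₂ → TwoComponents Γ L d₁ d₂ → TwoComponents Γ M e₁ e₂ →
    Cross Γ (Comp Γ K c₁) (Comp Γ K c₂) (Comp Γ L d₁) (Comp Γ L d₂) →
    Cross Γ (Comp Γ L d₁) (Comp Γ L d₂) (Comp Γ M e₁) (Comp Γ M e₂) →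
    ¬ (ContainsEnd Γ (_∩_ Γ (_∩_ Γ (Comp Γ K c₁) (Comp Γ L d₁)) (Comp Γ M e₁)) ×
    ContainsEnd Γ (_∩_ Γ (_∩_ Γ (Comp Γ K c₂) (Comp Γ L d₁)) (Comp Γ M e₂)) ×
    ContainsEnd Γ (_∩_ Γ (_∩_ Γ (Comp Γ K c₂) (Comp Γ L d₂)) (Comp Γ M e₁)) ×
    ContainsEnd Γ (_∩_ Γ (_∩_ Γ (Comp Γ K c₁) (Comp Γ L d₂)) (Comp Γ M e₂)))
mainTheorem13 Γ _ _ K L M mK mL mM _ _ _ _ _ _ twoK twoL twoM _ _ (α , β , γ , δ) =
  no-four-cells mK mL mM ends
  where
  open ThreeCuts twoK twoL twoM
  ends : ∀ e → ContainsEnd Γ (InCell e)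
  ends (false , false) = α
  ends (true , false) = β
  ends (true , true) = γ
  ends (false , true) = δ
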